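{- If $T$ is a tree with $n\ge2$ vertices, then $\tau_s(T)\le\lceil\log_2 n\rceil$.
   Context: For vertices $u,v,w$ of a connected graph, $w$ strongly resolves $u,v$ if there is a shortest $u$-$w$ path containing $v$ or a shortest $v$-$w$ path containing $u$. A strong resolving set is a set $W$ such that every pair of vertices is strongly resolved by some vertex of $W$; the strong dimension $\beta_s(H)$ is the minimum size of a strong resolving set of $H$. The threshold strong dimension $\tau_s(G)$ is the minimum of $\beta_s(H)$ over all graphs $H$ having $G$ as a spanning subgraph. -}

module Defs where

open import Data.Nat using (ℕ; zero; suc; _≤_; _≥_)
open import Data.Fin using (Fin)
open import Data.Fin.Subset using (Subset; ∣_∣) renaming (_∈_ to _∈ₛ_)
open import Data.List using (List; []; _∷_; length)
open import Data.List.Membership.Propositional using (_∈_)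
open import Data.List.Relation.Unary.Unique.Propositional using (Unique)
open import Data.List.Relation.Unary.Linked using (Linked)
open import Data.List using (last)
open import Data.Maybe using (just)
open import Data.Product using (Σ; ∃; _×_; _,_)
open import Data.Empty using (⊥)
open import Data.Sum using (_⊎_)
open import Relation.Nullary using (¬_)
open import Relation.Binary.PropositionalEquality using (_≡_)

record Graph (n : ℕ) : Set₁ where
  field
    Adj   : Fin n → Fin n → Set
    sym   : ∀ {u v} → Adj u v → Adj v u
    irrefl : ∀ {u} → ¬ Adj u u
open Graph public

module _ {n : ℕ} (G : Graph n) where

  data Walk : Fin n → Fin n → Set where
    here : ∀ {u} → Walk u u
    step : ∀ {u w v} → Adj G u w → Walk w v → Walk u v

  len : ∀ {u v} → Walk u v → ℕ
  len here = zero
  len (step _ p) = suc (len p)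

  verts : ∀ {u v} → Walk u v → List (Fin n)
  verts (here {u}) = u ∷ []
  verts (step {u} _ p) = u ∷ verts p

  Connected : Set
  Connected = ∀ u v → Walk u v

  IsCycle : List (Fin n) → Set
  IsCycle [] = ⊥
  IsCycle (x ∷ xs) =
    3 ≤ length (x ∷ xs) × Unique (x ∷ xs) × Linked (Adj G) (x ∷ xs)
    × Σ (Fin n) (λ y → (last (x ∷ xs) ≡ just y) × Adj G y x)

  Acyclic : Set
  Acyclic = ∀ cs → ¬ IsCycle cs

  IsTree : Set
  IsTree = Connected × Acyclic

  IsShortest : ∀ {u v} → Walk u v → Set
  IsShortest {u} {v} p = ∀ (q : Walk u v) → len p ≤ len q

  StronglyResolves : Fin n → Fin n → Fin n → Set
  StronglyResolves w u v =
    (Σ (Walk u w) λ p → IsShortest p × v ∈ verts p)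
    ⊎ (Σ (Walk v w) λ p → IsShortest p × u ∈ verts p)

  IsStrongResolvingSet : Subset n → Set
  IsStrongResolvingSet W =
    ∀ u v → ¬ u ≡ v → Σ (Fin n) λ w → (w ∈ₛ W) × StronglyResolves w u v

  -- β_s(G) ≤ k  (β_s is the minimum size of a strong resolving set).
  StrongDimAtMost : ℕ → Set
  StrongDimAtMost k = Σ (Subset n) λ W → IsStrongResolvingSet W × ∣ W ∣ ≤ k

_⊆ₛ_ : ∀ {n} → Graph n → Graph n → Set
G ⊆ₛ H = ∀ {u v} → Adj G u v → Adj H u v

-- τ_s(G) ≤ k : some H containing G as spanning subgraph (H is then
-- connected when G is) has β_s(H) ≤ k.
ThresholdStrongDimAtMost : ∀ {n} → Graph n → ℕ → Set₁
ThresholdStrongDimAtMost {n} G k =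
  Σ (Graph n) λ H → G ⊆ₛ H × Connected H × StrongDimAtMost H k

module Submission where

-- Since 0 < k < n ≤ 2 ^ k, it suffices to build H ⊇ T with a strong resolving
-- set of k vertices.  Number the vertices of T from a root so that every
-- other vertex has exactly one earlier neighbour, its parent (a parent
-- ordering: grow T from the root; uniqueness of the earlier neighbour is
-- acyclicity).  The last k vertices are the landmarks w₀, …, w_{k-1}, the
-- others form the core.  The code of a vertex y is the least j with y the
-- parent of w_j, or k + pos y if there is none; codes are injective and core
-- codes are below 2 ^ k.  H is the complete graph minus the edges w_j y with
-- y in the core and digit j of code y equal to 1.  A tree edge w_j y has
-- code y ≤ j < 2 ^ j, so it survives; the parent of w₀ has code 0 and is
-- adjacent to all vertices, so H has diameter ≤ 2.  A pair containing a
-- landmark is resolved by that landmark, and core vertices u, v whose codes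
-- differ at digit j (1 for u) lie on the shortest walk u — v — w_j.

open import Defs hiding (sym)
open import Function using (_∘_)
open import Data.Empty using (⊥-elim)
open import Data.Product using (Σ; ∃; _×_; _,_; proj₁; proj₂)
open import Data.Sum using (_⊎_; inj₁; inj₂)
import Data.Sum as Sum
open import Data.Maybe using (just)
open import Relation.Nullary using (¬_; Dec; yes; no)
open import Relation.Nullary.Decidable using (_×-dec_; ¬?; decidable-stable)
open import Relation.Binary.Definitions using (Decidable; DecidableEquality)
open import Relation.Binary.PropositionalEquality
open import Induction.WellFounded using (acc)

open import Data.Nat using (ℕ; zero; suc; _+_; _*_; _∸_; _^_; _≤_; _<_; _≥_; z≤n; s≤s; ⌊_/2⌋; ⌈_/2⌉; parity; _<?_)
open import Data.Nat.Properties
open import Data.Nat.Logarithm using (⌈log₂_⌉; ⌈log₂⌉-mono-≤; ⌈log₂2^n⌉≡n)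
open import Data.Nat.Logarithm.Core using (⌈log2⌉)
open import Data.Parity.Base using (Parity; 0ℙ; 1ℙ)
import Data.Parity.Properties as ℙ

open import Data.Fin using (Fin; toℕ)
import Data.Fin as F
import Data.Fin.Properties as FP
open import Data.Vec using (_∷_)
open import Data.Fin.Subset using (Subset; ∣_∣; ⁅_⁆; _∪_; inside; outside) renaming (_∈_ to _∈ₛ_; ⊥ to ∅)
import Data.Fin.Subset.Properties as SP

open import Data.List using (List; []; _∷_; length; last)
import Data.List as List
open import Data.List.Properties using (length-tabulate)
open import Data.List.Membership.Propositional using (_∈_; _∉_)
open import Data.List.Membership.Propositional.Properties using (∈-tabulate⁺)
import Data.List.Membership.DecPropositional as DecMembership
open import Data.List.Relation.Binary.Subset.Propositional using (_⊆_)
open import Data.List.Relation.Unary.Any using (here; there)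
import Data.List.Relation.Unary.Any as Any
open import Data.List.Relation.Unary.Any.Properties using (lookup-index)
open import Data.List.Relation.Unary.All using ([])
import Data.List.Relation.Unary.All as All
open import Data.List.Relation.Unary.All.Properties using (¬Any⇒All¬)
open import Data.List.Relation.Unary.AllPairs using ([]; _∷_)
open import Data.List.Relation.Unary.Unique.Propositional using (Unique)
open import Data.List.Relation.Unary.Linked using (Linked; [-]; _∷_)

n<2^n : ∀ n → n < 2 ^ n
n<2^n zero    = s≤s z≤n
n<2^n (suc n) = begin
  2 + n           ≤⟨ +-mono-≤ (m^n>0 2 n) (n<2^n n) ⟩
  2 ^ n + 2 ^ n   ≡⟨ cong (2 ^ n +_) (sym (+-identityʳ (2 ^ n))) ⟩
  2 ^ suc n       ∎
  where open ≤-Reasoning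

0ℙ≢1ℙ : 0ℙ ≢ 1ℙ
0ℙ≢1ℙ ()

digit : ℕ → ℕ → Parity
digit zero    a = parity a
digit (suc j) a = digit j ⌊ a /2⌋

⌊a/2⌋<c : ∀ a c → a < 2 * c → ⌊ a /2⌋ < c
⌊a/2⌋<c a c a<2c = begin
  ⌊ 2 + a /2⌋       ≤⟨ ⌊n/2⌋-mono (s≤s a<2c) ⟩
  ⌈ 2 * c /2⌉       ≡⟨ cong (λ z → ⌈ c + z /2⌉) (+-identityʳ c) ⟩
  ⌈ c + c /2⌉       ≡⟨ sym (n≡⌈n+n/2⌉ c) ⟩
  c                 ∎
  where open ≤-Reasoning

digit-high : ∀ j a → a < 2 ^ j → digit j a ≡ 0ℙ
digit-high zero    zero    _        = refl
digit-high zero    (suc a) (s≤s ())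
digit-high (suc j) a       a<2^1+j  = digit-high j ⌊ a /2⌋ (⌊a/2⌋<c a (2 ^ j) a<2^1+j)

parity-half-injective : ∀ a b → parity a ≡ parity b → ⌊ a /2⌋ ≡ ⌊ b /2⌋ → a ≡ b
parity-half-injective zero          zero          _  _ = refl
parity-half-injective (suc zero)    (suc zero)    _  _ = refl
parity-half-injective (suc (suc a)) (suc (suc b)) pe he =
  cong (suc ∘ suc) (parity-half-injective a b pe (suc-injective he))
parity-half-injective zero          (suc zero)    () _
parity-half-injective (suc zero)    zero          () _
parity-half-injective zero          (suc (suc b)) _  ()
parity-half-injective (suc (suc a)) zero          _  ()
parity-half-injective (suc zero)    (suc (suc b)) _  ()
parity-half-injective (suc (suc a)) (suc zero)    _  ()

digits-injective : ∀ k a b → a < 2 ^ k → b < 2 ^ k →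
  (∀ (j : Fin k) → digit (toℕ j) a ≡ digit (toℕ j) b) → a ≡ b
digits-injective zero    zero    zero    _        _        _    = refl
digits-injective zero    (suc a) _       (s≤s ()) _        _
digits-injective zero    zero    (suc b) _        (s≤s ()) _
digits-injective (suc k) a       b       a<       b<       same =
  parity-half-injective a b (same F.zero)
    (digits-injective k ⌊ a /2⌋ ⌊ b /2⌋ (⌊a/2⌋<c a _ a<) (⌊a/2⌋<c b _ b<) (same ∘ F.suc))

distinguishing-digit : ∀ k {a b} → a < 2 ^ k → b < 2 ^ k → a ≢ b →
  ∃ λ (j : Fin k) → digit (toℕ j) a ≢ digit (toℕ j) b
distinguishing-digit k {a} {b} a< b< a≢b =
  FP.¬∀⟶∃¬ k _ (λ j → digit (toℕ j) a ℙ.≟ digit (toℕ j) b) (a≢b ∘ digits-injective k a b a< b<)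

-- Bounds on k = ⌈log₂ n⌉: n ≤ 2 ^ k (by induction along the recursion
-- defining ⌈log₂⌉, which passes from n + 2 to ⌈n/2⌉ + 1), k < n and 0 < k.
n≤2*⌈n/2⌉ : ∀ n → n ≤ 2 * ⌈ n /2⌉
n≤2*⌈n/2⌉ n = begin
  n                     ≡⟨ sym (⌊n/2⌋+⌈n/2⌉≡n n) ⟩
  ⌊ n /2⌋ + ⌈ n /2⌉     ≤⟨ +-monoˡ-≤ ⌈ n /2⌉ (⌊n/2⌋≤⌈n/2⌉ n) ⟩
  ⌈ n /2⌉ + ⌈ n /2⌉     ≡⟨ cong (⌈ n /2⌉ +_) (sym (+-identityʳ ⌈ n /2⌉)) ⟩
  2 * ⌈ n /2⌉           ∎
  where open ≤-Reasoning

n≤2^⌈log2⌉ : ∀ n acc → n ≤ 2 ^ ⌈log2⌉ n acc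
n≤2^⌈log2⌉ zero          _        = z≤n
n≤2^⌈log2⌉ (suc zero)    _        = s≤s z≤n
n≤2^⌈log2⌉ (suc (suc n)) (acc rs) = begin
  2 + n                  ≤⟨ s≤s (s≤s (n≤2*⌈n/2⌉ n)) ⟩
  2 + 2 * ⌈ n /2⌉        ≡⟨ sym (*-suc 2 ⌈ n /2⌉) ⟩
  2 * suc ⌈ n /2⌉        ≤⟨ *-monoʳ-≤ 2 (n≤2^⌈log2⌉ (suc ⌈ n /2⌉) (rs (⌈n/2⌉<n n))) ⟩
  2 ^ ⌈log2⌉ (suc (suc n)) (acc rs) ∎
  where open ≤-Reasoning

n≤2^⌈log₂n⌉ : ∀ n → n ≤ 2 ^ ⌈log₂ n ⌉
n≤2^⌈log₂n⌉ n = n≤2^⌈log2⌉ n _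

⌈log₂n⌉<n : ∀ n → ⌈log₂ suc n ⌉ < suc n
⌈log₂n⌉<n n = s≤s (subst (⌈log₂ suc n ⌉ ≤_) (⌈log₂2^n⌉≡n n) (⌈log₂⌉-mono-≤ (n<2^n n)))

0<⌈log₂n⌉ : ∀ {n} → n ≥ 2 → 0 < ⌈log₂ n ⌉
0<⌈log₂n⌉ n≥2 = ⌈log₂⌉-mono-≤ n≥2

module _ {n : ℕ} (G : Graph n) where
  open DecMembership (FP._≟_ {n}) using (_∈?_)

  start∈verts : ∀ {u v} (p : Walk G u v) → u ∈ verts G p
  start∈verts here       = here refl
  start∈verts (step _ p) = here refl

  end∈verts : ∀ {u v} (p : Walk G u v) → v ∈ verts G p
  end∈verts here       = here refl
  end∈verts (step _ p) = there (end∈verts p)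

  _++ʷ_ : ∀ {a b c} → Walk G a b → Walk G b c → Walk G a c
  here     ++ʷ q = q
  step e p ++ʷ q = step e (p ++ʷ q)

  ∈-++ʷ : ∀ {a b c y} (p : Walk G a b) (q : Walk G b c) →
    y ∈ verts G (p ++ʷ q) → y ∈ verts G p ⊎ y ∈ verts G q
  ∈-++ʷ here       q y∈            = inj₂ y∈
  ∈-++ʷ (step e p) q (here refl)   = inj₁ (here refl)
  ∈-++ʷ (step e p) q (there y∈)    = Sum.map₁ there (∈-++ʷ p q y∈)

  reverseʷ : ∀ {a b} → Walk G a b → Walk G b a
  reverseʷ here       = here
  reverseʷ (step e p) = reverseʷ p ++ʷ step (Graph.sym G e) here

  ∈-reverseʷ : ∀ {a b y} (p : Walk G a b) → y ∈ verts G (reverseʷ p) → y ∈ verts G p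
  ∈-reverseʷ here       y∈ = y∈
  ∈-reverseʷ (step e p) y∈ with ∈-++ʷ (reverseʷ p) (step (Graph.sym G e) here) y∈
  ... | inj₁ y∈p                 = there (∈-reverseʷ p y∈p)
  ... | inj₂ (here refl)         = there (start∈verts p)
  ... | inj₂ (there (here refl)) = here refl

  suffixʷ : ∀ {a b x} (q : Walk G a b) → x ∈ verts G q →
    Σ (Walk G x b) λ s → verts G s ⊆ verts G q × (Unique (verts G q) → Unique (verts G s))
  suffixʷ here       (here refl) = here , (λ y∈ → y∈) , (λ u → u)
  suffixʷ (step e q) (here refl) = step e q , (λ y∈ → y∈) , (λ u → u)
  suffixʷ (step e q) (there x∈) with suffixʷ q x∈
  ... | s , s⊆q , uniq = s , there ∘ s⊆q , λ { (_ ∷ u) → uniq u }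

  loopErase : ∀ {a b} (p : Walk G a b) →
    Σ (Walk G a b) λ q → Unique (verts G q) × verts G q ⊆ verts G p
  loopErase here = here , ([] ∷ []) , (λ y∈ → y∈)
  loopErase {a} (step e p) with loopErase p
  ... | q , uq , q⊆p with a ∈? verts G q
  ...   | yes a∈q = let s , s⊆q , uniq = suffixʷ q a∈q in s , uniq uq , there ∘ q⊆p ∘ s⊆q
  ...   | no  a∉q = step e q , (¬Any⇒All¬ _ a∉q ∷ uq) ,
                      λ { (here refl) → here refl ; (there y∈) → there (q⊆p y∈) }

  closeCycle : ∀ {w u p} (q : Walk G u p) → Unique (verts G q) → w ∉ verts G q → u ≢ p →
    Adj G w u → Adj G p w → IsCycle G (w ∷ verts G q)
  closeCycle {w} q uq w∉q u≢p wu pw =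
    s≤s (two-vertices q u≢p) , (¬Any⇒All¬ _ w∉q ∷ uq) , linked wu q , (_ , last-vertex q , pw)
    where
    two-vertices : ∀ {a b} (q : Walk G a b) → a ≢ b → 2 ≤ length (verts G q)
    two-vertices here           a≢b = ⊥-elim (a≢b refl)
    two-vertices (step _ here)  _   = s≤s (s≤s z≤n)
    two-vertices (step _ (step _ _)) _ = s≤s (s≤s z≤n)
    linked : ∀ {x a b} → Adj G x a → (q : Walk G a b) → Linked (Adj G) (x ∷ verts G q)
    linked xa here       = xa ∷ [-]
    linked xa (step e q) = xa ∷ linked e q
    last-vertex : ∀ {x a b} (q : Walk G a b) → last (x ∷ verts G q) ≡ just b
    last-vertex here       = refl
    last-vertex (step _ q) = last-vertex q

  -- In an acyclic graph, a vertex w has at most one neighbour among the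
  -- vertices of a walk avoiding w (joining two neighbours would close a cycle).
  single-attachment : Acyclic G → ∀ {w u p} (q : Walk G u p) → w ∉ verts G q →
    Adj G w u → Adj G w p → u ≡ p
  single-attachment acyclic {u = u} {p} q w∉q wu wp with u FP.≟ p
  ... | yes u≡p = u≡p
  ... | no  u≢p = let q′ , uq′ , q′⊆q = loopErase q in
    ⊥-elim (acyclic _ (closeCycle q′ uq′ (w∉q ∘ q′⊆q) u≢p wu (Graph.sym G wp)))

  crossingEdge : ∀ {L a b} → Walk G a b → a ∈ L → b ∉ L →
    Σ (Fin n) λ c → Σ (Fin n) λ d → c ∈ L × d ∉ L × Adj G d c
  crossingEdge here                 a∈ b∉ = ⊥-elim (b∉ a∈)
  crossingEdge {L} (step {a} {w} e p) a∈ b∉ with w ∈? L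
  ... | yes w∈ = crossingEdge p w∈ b∉
  ... | no  w∉ = a , w , a∈ , w∉ , Graph.sym G e

  shortest-here : ∀ {u} → IsShortest G (here {u = u})
  shortest-here _ = z≤n

  shortest-edge : ∀ {u v} (uv : Adj G u v) → IsShortest G (step uv here)
  shortest-edge uv here       = ⊥-elim (Graph.irrefl G uv)
  shortest-edge uv (step _ _) = s≤s z≤n

  shortest-path2 : ∀ {u v w} (uv : Adj G u v) (vw : Adj G v w) → u ≢ w → ¬ Adj G u w →
    IsShortest G (step uv (step vw here))
  shortest-path2 uv vw u≢w ¬uw here                  = ⊥-elim (u≢w refl)
  shortest-path2 uv vw u≢w ¬uw (step uw here)        = ⊥-elim (¬uw uw)
  shortest-path2 uv vw u≢w ¬uw (step _ (step _ _))   = s≤s (s≤s z≤n)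

  geodesic : Decidable (Adj G) → (h : Fin n) → (∀ x → x ≢ h → Adj G x h) →
    ∀ x y → Σ (Walk G x y) (IsShortest G)
  geodesic adj? h dominating x y with x FP.≟ y | adj? x y
  ... | yes refl | _      = here , shortest-here
  ... | no  _    | yes xy = step xy here , shortest-edge xy
  ... | no  x≢y  | no ¬xy = step xh (step hy here) , shortest-path2 xh hy x≢y ¬xy
    where
    x≢h : x ≢ h
    x≢h refl = ¬xy (Graph.sym G (dominating y (x≢y ∘ sym)))
    y≢h : y ≢ h
    y≢h refl = ¬xy (dominating x x≢y)
    xh : Adj G x h
    xh = dominating x x≢h
    hy : Adj G h y
    hy = Graph.sym G (dominating y y≢h)

  endpoint-resolves : ∀ {u v} → Σ (Walk G u v) (IsShortest G) → StronglyResolves G v u v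
  endpoint-resolves (p , shortest) = inj₁ (p , shortest , end∈verts p)

-- Ranks in a duplicate-free list: rank L x counts the entries of L after x,
-- so the last entry has rank 0 and the head has rank length L - 1.
module Rank {A : Set} (_≟_ : DecidableEquality A) where

  rank : List A → A → ℕ
  rank []       x = 0
  rank (y ∷ ys) x with x ≟ y
  ... | yes _ = length ys
  ... | no  _ = rank ys x

  rank-head : ∀ x xs → rank (x ∷ xs) x ≡ length xs
  rank-head x xs with x ≟ x
  ... | yes _   = refl
  ... | no  x≢x = ⊥-elim (x≢x refl)

  rank-tail : ∀ {x y ys} → x ≢ y → rank (y ∷ ys) x ≡ rank ys x
  rank-tail {x} {y} x≢y with x ≟ y
  ... | yes x≡y = ⊥-elim (x≢y x≡y)
  ... | no  _   = refl

  rank<length : ∀ {L x} → x ∈ L → rank L x < length L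
  rank<length {y ∷ ys} {x} x∈ with x ≟ y | x∈
  ... | yes _   | _         = ≤-refl
  ... | no  _   | there x∈′ = m≤n⇒m≤1+n (rank<length x∈′)
  ... | no  x≢y | here x≡y  = ⊥-elim (x≢y x≡y)

  rank-injective : ∀ {L x y} → Unique L → x ∈ L → y ∈ L → rank L x ≡ rank L y → x ≡ y
  rank-injective _ (here refl) (here refl) _ = refl
  rank-injective {h ∷ ys} (h∉ ∷ _) (here refl) (there y∈) e =
    ⊥-elim (<⇒≢ (rank<length y∈) (trans (sym (rank-tail (All.lookup h∉ y∈ ∘ sym))) (trans (sym e) (rank-head h ys))))
  rank-injective {h ∷ ys} (h∉ ∷ _) (there x∈) (here refl) e =
    ⊥-elim (<⇒≢ (rank<length x∈) (trans (sym (rank-tail (All.lookup h∉ x∈ ∘ sym))) (trans e (rank-head h ys))))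
  rank-injective (h∉ ∷ u) (there x∈) (there y∈) e =
    rank-injective u x∈ y∈
      (trans (sym (rank-tail (All.lookup h∉ x∈ ∘ sym))) (trans e (rank-tail (All.lookup h∉ y∈ ∘ sym))))

  rank-surjective : ∀ {L} → Unique L → ∀ t → t < length L → ∃ λ x → x ∈ L × rank L x ≡ t
  rank-surjective {h ∷ ys} (h∉ ∷ u) t (s≤s t≤) with m≤n⇒m<n∨m≡n t≤
  ... | inj₂ refl = h , here refl , rank-head h ys
  ... | inj₁ t<   = let x , x∈ , e = rank-surjective u t t< in
    x , there x∈ , trans (rank-tail (All.lookup h∉ x∈ ∘ sym)) e

module _ {n : ℕ} where
  open Rank (FP._≟_ {n})

  unique⇒length≤ : ∀ {L : List (Fin n)} → Unique L → length L ≤ n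
  unique⇒length≤ {L} u = FP.injective⇒≤ {f = entryOfRank} injective
    where
    entryOfRank : Fin (length L) → Fin n
    entryOfRank t = proj₁ (rank-surjective u (toℕ t) (FP.toℕ<n t))
    injective : ∀ {s t} → entryOfRank s ≡ entryOfRank t → s ≡ t
    injective {s} {t} e = FP.toℕ-injective (begin
      toℕ s                  ≡⟨ sym (proj₂ (proj₂ (rank-surjective u (toℕ s) (FP.toℕ<n s)))) ⟩
      rank L (entryOfRank s) ≡⟨ cong (rank L) e ⟩
      rank L (entryOfRank t) ≡⟨ proj₂ (proj₂ (rank-surjective u (toℕ t) (FP.toℕ<n t))) ⟩
      toℕ t                  ∎)
      where open ≡-Reasoning

  complete⇒n≤length : ∀ {L : List (Fin n)} → (∀ x → x ∈ L) → n ≤ length L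
  complete⇒n≤length {L} complete = FP.injective⇒≤ {f = Any.index ∘ complete} injective
    where
    injective : ∀ {x y} → Any.index (complete x) ≡ Any.index (complete y) → x ≡ y
    injective {x} {y} e =
      trans (lookup-index (complete x)) (trans (cong (List.lookup L) e) (sym (lookup-index (complete y))))

listSubset : ∀ {n} → List (Fin n) → Subset n
listSubset []       = ∅
listSubset (x ∷ xs) = ⁅ x ⁆ ∪ listSubset xs

∈-listSubset : ∀ {n} {x : Fin n} {xs} → x ∈ xs → x ∈ₛ listSubset xs
∈-listSubset {x = x} (here refl) = SP.x∈p∪q⁺ (inj₁ (SP.x∈⁅x⁆ x))
∈-listSubset         (there x∈)  = SP.x∈p∪q⁺ (inj₂ (∈-listSubset x∈))

∣⁅x⁆∪p∣≤1+∣p∣ : ∀ {n} (x : Fin n) (p : Subset n) → ∣ ⁅ x ⁆ ∪ p ∣ ≤ suc ∣ p ∣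
∣⁅x⁆∪p∣≤1+∣p∣ F.zero    (s ∷ p) =
  s≤s (subst (λ q → ∣ q ∣ ≤ ∣ s ∷ p ∣) (sym (SP.∪-identityˡ p)) (SP.∣p∣≤∣x∷p∣ s p))
∣⁅x⁆∪p∣≤1+∣p∣ (F.suc x) (inside  ∷ p) = s≤s (∣⁅x⁆∪p∣≤1+∣p∣ x p)
∣⁅x⁆∪p∣≤1+∣p∣ (F.suc x) (outside ∷ p) = ∣⁅x⁆∪p∣≤1+∣p∣ x p

∣listSubset∣≤length : ∀ {n} (xs : List (Fin n)) → ∣ listSubset xs ∣ ≤ length xs
∣listSubset∣≤length {n} []       = ≤-reflexive (SP.∣⊥∣≡0 n)
∣listSubset∣≤length (x ∷ xs) = ≤-trans (∣⁅x⁆∪p∣≤1+∣p∣ x (listSubset xs)) (s≤s (∣listSubset∣≤length xs))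

record ParentOrdering {n : ℕ} (T : Graph n) : Set where
  field
    pos               : Fin n → ℕ
    pos<n             : ∀ v → pos v < n
    pos-injective     : ∀ {u v} → pos u ≡ pos v → u ≡ v
    pos-surjective    : ∀ t → t < n → ∃ λ v → pos v ≡ t
    parent            : Fin n → Fin n
    parent-earlier    : ∀ v → 0 < pos v → pos (parent v) < pos v
    earlier-neighbour : ∀ {u w} → Adj T u w → pos u < pos w → u ≡ parent w

-- Growing a tree from a root r: lists (newest vertex first) obtained from [r]
-- by repeatedly attaching a new vertex v to an existing vertex p.
module Growth {n : ℕ} (T : Graph n) (r : Fin n) where
  open Rank (FP._≟_ {n})
  open DecMembership (FP._≟_ {n}) using (_∈?_)

  data Grown : List (Fin n) → Set where
    seed   : Grown (r ∷ [])
    attach : ∀ {L v p} → Grown L → v ∉ L → p ∈ L → Adj T v p → Grown (v ∷ L)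

  grown-unique : ∀ {L} → Grown L → Unique L
  grown-unique seed             = [] ∷ []
  grown-unique (attach g v∉ _ _) = ¬Any⇒All¬ _ v∉ ∷ grown-unique g

  root∈ : ∀ {L} → Grown L → r ∈ L
  root∈ seed               = here refl
  root∈ (attach g _ _ _)   = there (root∈ g)

  -- The vertex each vertex was attached to (the root is its own parent).
  parent : ∀ {L} → Grown L → Fin n → Fin n
  parent seed                          x = r
  parent (attach {v = v} {p} g _ _ _) x with x FP.≟ v
  ... | yes _ = p
  ... | no  _ = parent g x

  parent-earlier : ∀ {L} (g : Grown L) {x} → x ∈ L → 0 < rank L x →
    parent g x ∈ L × rank L (parent g x) < rank L x
  parent-earlier seed (here refl) 0<rank = ⊥-elim (<⇒≢ 0<rank (sym (rank-head r [])))
  parent-earlier (attach {L} {v} {p} g v∉ p∈ _) {x} x∈ 0<rank with x FP.≟ v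
  ... | yes refl = there p∈ , subst (_< length L) (sym (rank-tail {ys = L} λ { refl → v∉ p∈ })) (rank<length p∈)
  ... | no  x≢v  with parent-earlier g (Any.tail x≢v x∈) 0<rank
  ...   | p′∈ , earlier = there p′∈ , subst (_< rank L x) (sym (rank-tail {ys = L} λ { refl → v∉ p′∈ })) earlier

  walkToRoot : ∀ {L} → Grown L → ∀ {x} → x ∈ L → Σ (Walk T x r) λ q → verts T q ⊆ L
  walkToRoot seed (here refl) = here , λ y∈ → y∈
  walkToRoot (attach g _ p∈ vp) (here refl) =
    let q , q⊆ = walkToRoot g p∈ in step vp q , λ { (here refl) → here refl ; (there y∈) → there (q⊆ y∈) }
  walkToRoot (attach g _ _ _) (there x∈) = let q , q⊆ = walkToRoot g x∈ in q , there ∘ q⊆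

  walkWithin : ∀ {L} → Grown L → ∀ {x y} → x ∈ L → y ∈ L → Σ (Walk T x y) λ q → verts T q ⊆ L
  walkWithin g x∈ y∈ =
    let qx , qx⊆ = walkToRoot g x∈ ; qy , qy⊆ = walkToRoot g y∈ in
    _++ʷ_ T qx (reverseʷ T qy) , λ z∈ → Sum.[ qx⊆ , qy⊆ ∘ ∈-reverseʷ T qy ] (∈-++ʷ T qx (reverseʷ T qy) z∈)

  earlier-neighbour : Acyclic T → ∀ {L} (g : Grown L) {u w} → Adj T u w → u ∈ L → w ∈ L →
    rank L u < rank L w → u ≡ parent g w
  earlier-neighbour acyclic seed uw (here refl) (here refl) u<w = ⊥-elim (<-irrefl refl u<w)
  earlier-neighbour acyclic (attach {L} {v} {p} g v∉ p∈ vp) {u} {w} uw u∈ w∈ u<w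
    with w FP.≟ v | u FP.≟ v
  ... | yes refl | yes refl = ⊥-elim (<-irrefl refl u<w)
  ... | yes refl | no u≢v   =
    let u∈L = Any.tail u≢v u∈ ; q , q⊆ = walkWithin g u∈L p∈ in
    single-attachment T acyclic q (v∉ ∘ q⊆) (Graph.sym T uw) vp
  ... | no w≢v   | yes refl =
    ⊥-elim (<-asym u<w (rank<length (Any.tail w≢v w∈)))
  ... | no w≢v   | no u≢v   =
    earlier-neighbour acyclic g uw (Any.tail u≢v u∈) (Any.tail w≢v w∈) u<w

  growAll : Connected T → ∀ fuel {L} → Grown L → n ≤ fuel + length L →
    ∃ λ L′ → Grown L′ × (∀ x → x ∈ L′)
  growAll connected fuel {L} g n≤ with FP.all? (λ x → x ∈? L)
  ... | yes complete = L , g , complete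
  ... | no incomplete with FP.¬∀⟶∃¬ n _ (λ x → x ∈? L) incomplete
  ...   | x , x∉ with crossingEdge T (connected r x) (root∈ g) x∉
  ...     | c , d , c∈ , d∉ , dc with fuel
  ...       | zero     = ⊥-elim (<-irrefl refl (≤-trans (unique⇒length≤ (grown-unique (attach g d∉ c∈ dc))) n≤))
  ...       | suc fuel = growAll connected fuel (attach g d∉ c∈ dc) (subst (n ≤_) (sym (+-suc fuel (length L))) n≤)

treeOrdering : ∀ {n} (T : Graph n) → IsTree T → Fin n → ParentOrdering T
treeOrdering {n} T (connected , acyclic) r = record
  { pos               = rank L
  ; pos<n             = λ v → subst (rank L v <_) length≡n (rank<length (complete v))
  ; pos-injective     = λ {u} {v} → rank-injective (grown-unique g) (complete u) (complete v)
  ; pos-surjective    = λ t t<n →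
      let v , _ , e = rank-surjective (grown-unique g) t (subst (t <_) (sym length≡n) t<n) in v , e
  ; parent            = parent g
  ; parent-earlier    = λ v 0<pos → proj₂ (parent-earlier g (complete v) 0<pos)
  ; earlier-neighbour = λ {u} {w} uw → earlier-neighbour acyclic g uw (complete u) (complete w)
  }
  where
  open Rank (FP._≟_ {n})
  open Growth T r
  grown : ∃ λ L → Grown L × (∀ x → x ∈ L)
  grown = growAll connected n seed (m≤m+n n 1)
  L = proj₁ grown
  g = proj₁ (proj₂ grown)
  complete = proj₂ (proj₂ grown)
  length≡n : length L ≡ n
  length≡n = ≤-antisym (unique⇒length≤ (grown-unique g)) (complete⇒n≤length complete)

module Extension {n : ℕ} (T : Graph n) (O : ParentOrdering T)
                 (k : ℕ) (0<k : 0 < k) (k<n : k < n) (n≤2^k : n ≤ 2 ^ k) where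
  open ParentOrdering O

  m : ℕ
  m = n ∸ k

  k+m≡n : k + m ≡ n
  k+m≡n = m+[n∸m]≡n (<⇒≤ k<n)

  IsCore : Fin n → Set
  IsCore v = pos v < m

  landmark : Fin k → Fin n
  landmark j = proj₁ (pos-surjective (m + toℕ j) m+j<n)
    where
    m+j<n : m + toℕ j < n
    m+j<n = subst (m + toℕ j <_) (trans (+-comm m k) k+m≡n) (+-monoʳ-< m (FP.toℕ<n j))

  pos-landmark : ∀ j → pos (landmark j) ≡ m + toℕ j
  pos-landmark j = proj₂ (pos-surjective (m + toℕ j) _)

  landmark-not-core : ∀ j → ¬ IsCore (landmark j)
  landmark-not-core j core = <⇒≱ core (subst (m ≤_) (sym (pos-landmark j)) (m≤m+n m (toℕ j)))

  landmark-injective : ∀ {i j} → landmark i ≡ landmark j → i ≡ j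
  landmark-injective {i} {j} e =
    FP.toℕ-injective (+-cancelˡ-≡ m _ _ (trans (sym (pos-landmark i)) (trans (cong pos e) (pos-landmark j))))

  landmark-cover : ∀ v → ¬ IsCore v → ∃ λ j → landmark j ≡ v
  landmark-cover v not-core = j , pos-injective (trans (pos-landmark j) pos≡)
    where
    m≤pos : m ≤ pos v
    m≤pos = ≮⇒≥ not-core
    offset<k : pos v ∸ m < k
    offset<k = +-cancelˡ-< m _ _ (subst₂ _<_ (sym (m+[n∸m]≡n m≤pos)) (sym (trans (+-comm m k) k+m≡n)) (pos<n v))
    j : Fin k
    j = F.fromℕ< offset<k
    pos≡ : m + toℕ j ≡ pos v
    pos≡ = trans (cong (m +_) (FP.toℕ-fromℕ< offset<k)) (m+[n∸m]≡n m≤pos)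

  HasLandmarkChild : Fin n → Set
  HasLandmarkChild y = ∃ λ j → parent (landmark j) ≡ y

  hasLandmarkChild? : ∀ y → Dec (HasLandmarkChild y)
  hasLandmarkChild? y = FP.any? (λ j → parent (landmark j) FP.≟ y)

  FirstLandmarkChild : Fin n → Fin k → Set
  FirstLandmarkChild y i = parent (landmark i) ≡ y × (∀ j → parent (landmark j) ≡ y → toℕ i ≤ toℕ j)

  firstLandmarkChild : ∀ y → HasLandmarkChild y → ∃ (FirstLandmarkChild y)
  firstLandmarkChild y (j , jy)
    with FP.¬∀⟶∃¬-smallest k (λ i → parent (landmark i) ≢ y)
                              (λ i → ¬? (parent (landmark i) FP.≟ y)) (λ none → none j jy)
  ... | i , ¬¬iy , none-before = i , decidable-stable (parent (landmark i) FP.≟ y) ¬¬iy , first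
    where
    first : ∀ j → parent (landmark j) ≡ y → toℕ i ≤ toℕ j
    first j jy = ≮⇒≥ λ j<i → none-before (F.fromℕ< j<i)
      (subst (λ z → parent (landmark z) ≡ y)
             (sym (FP.toℕ-injective (trans (FP.toℕ-inject (F.fromℕ< j<i)) (FP.toℕ-fromℕ< j<i)))) jy)

  -- The code is computed from the decision whether y has a landmark child;
  -- its properties are proved by cases on that decision.
  codeFrom : ∀ y → Dec (HasLandmarkChild y) → ℕ
  codeFrom y (yes c) = toℕ (proj₁ (firstLandmarkChild y c))
  codeFrom y (no _)  = k + pos y

  code : Fin n → ℕ
  code y = codeFrom y (hasLandmarkChild? y)

  codeFrom-child : ∀ y d j → parent (landmark j) ≡ y → codeFrom y d ≤ toℕ j
  codeFrom-child y (yes c) j jy = proj₂ (proj₂ (firstLandmarkChild y c)) j jy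
  codeFrom-child y (no ¬c) j jy = ⊥-elim (¬c (j , jy))

  codeFrom-injective : ∀ u v du dv → codeFrom u du ≡ codeFrom v dv → u ≡ v
  codeFrom-injective u v (yes cu) (yes cv) e =
    let i , iu , _ = firstLandmarkChild u cu ; i′ , i′v , _ = firstLandmarkChild v cv in
    trans (sym iu) (trans (cong (parent ∘ landmark) (FP.toℕ-injective e)) i′v)
  codeFrom-injective u v (yes cu) (no _) e =
    ⊥-elim (<⇒≢ (≤-trans (FP.toℕ<n (proj₁ (firstLandmarkChild u cu))) (m≤m+n k (pos v))) e)
  codeFrom-injective u v (no _) (yes cv) e =
    ⊥-elim (<⇒≢ (≤-trans (FP.toℕ<n (proj₁ (firstLandmarkChild v cv))) (m≤m+n k (pos u))) (sym e))
  codeFrom-injective u v (no _) (no _) e = pos-injective (+-cancelˡ-≡ k _ _ e)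

  codeFrom<2^k : ∀ y d → IsCore y → codeFrom y d < 2 ^ k
  codeFrom<2^k y (yes c) _    = <-trans (FP.toℕ<n (proj₁ (firstLandmarkChild y c))) (n<2^n k)
  codeFrom<2^k y (no _)  core = ≤-trans (subst (k + pos y <_) k+m≡n (+-monoʳ-< k core)) n≤2^k

  code-child : ∀ {y} j → parent (landmark j) ≡ y → code y ≤ toℕ j
  code-child {y} = codeFrom-child y (hasLandmarkChild? y)

  code-injective : ∀ {u v} → code u ≡ code v → u ≡ v
  code-injective {u} {v} = codeFrom-injective u v (hasLandmarkChild? u) (hasLandmarkChild? v)

  code<2^k : ∀ {y} → IsCore y → code y < 2 ^ k
  code<2^k {y} = codeFrom<2^k y (hasLandmarkChild? y)

  Cut : Fin n → Fin n → Set
  Cut x y = ∃ λ j → x ≡ landmark j × IsCore y × digit (toℕ j) (code y) ≡ 1ℙ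

  cut? : ∀ x y → Dec (Cut x y)
  cut? x y = FP.any? λ j → (x FP.≟ landmark j) ×-dec ((pos y <? m) ×-dec (digit (toℕ j) (code y) ℙ.≟ 1ℙ))

  cut-not-core : ∀ {x y} → Cut x y → ¬ IsCore x
  cut-not-core (j , refl , _) = landmark-not-core j

  HAdj : Fin n → Fin n → Set
  HAdj x y = x ≢ y × ¬ Cut x y × ¬ Cut y x

  H : Graph n
  H = record
    { Adj    = HAdj
    ; sym    = λ { (x≢y , ¬xy , ¬yx) → x≢y ∘ sym , ¬yx , ¬xy }
    ; irrefl = λ { (x≢x , _) → x≢x refl }
    }

  HAdj? : ∀ x y → Dec (HAdj x y)
  HAdj? x y = ¬? (x FP.≟ y) ×-dec (¬? (cut? x y) ×-dec ¬? (cut? y x))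

  core-adjacent : ∀ {x y} → IsCore x → IsCore y → x ≢ y → HAdj x y
  core-adjacent x-core y-core x≢y = x≢y , (λ c → cut-not-core c x-core) , (λ c → cut-not-core c y-core)

  -- No tree edge is cut: a core neighbour y of landmark j is its parent, so
  -- code y ≤ j < 2 ^ j and digit j of code y is 0.
  tree-edge-uncut : ∀ {x y} → Adj T y x → ¬ Cut x y
  tree-edge-uncut {y = y} yx (j , refl , y-core , digit≡1) =
    0ℙ≢1ℙ (trans (sym (digit-high (toℕ j) (code y) code<2^j)) digit≡1)
    where
    y≡parent : y ≡ parent (landmark j)
    y≡parent = earlier-neighbour yx (<-≤-trans y-core (subst (m ≤_) (sym (pos-landmark j)) (m≤m+n m (toℕ j))))
    code<2^j : code y < 2 ^ toℕ j
    code<2^j = ≤-<-trans (code-child j (sym y≡parent)) (n<2^n (toℕ j))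

  T⊆H : T ⊆ₛ H
  T⊆H {u} {v} uv = (λ { refl → Graph.irrefl T uv }) , tree-edge-uncut (Graph.sym T uv) , tree-edge-uncut uv

  j₀ : Fin k
  j₀ = F.fromℕ< 0<k

  hub : Fin n
  hub = parent (landmark j₀)

  hub-core : IsCore hub
  hub-core = subst (pos hub <_) pos≡m (parent-earlier (landmark j₀) (subst (0 <_) (sym pos≡m) (m<n⇒0<n∸m k<n)))
    where
    pos≡m : pos (landmark j₀) ≡ m
    pos≡m = trans (pos-landmark j₀) (trans (cong (m +_) (FP.toℕ-fromℕ< 0<k)) (+-identityʳ m))

  hub-adjacent : ∀ x → x ≢ hub → HAdj x hub
  hub-adjacent x x≢hub = x≢hub , hub-uncut , λ c → cut-not-core c hub-core
    where
    code-hub≡0 : code hub ≡ 0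
    code-hub≡0 = n≤0⇒n≡0 (subst (code hub ≤_) (FP.toℕ-fromℕ< 0<k) (code-child j₀ refl))
    hub-uncut : ¬ Cut x hub
    hub-uncut (j , _ , _ , digit≡1) = 0ℙ≢1ℙ (trans (sym digit≡0) digit≡1)
      where
      digit≡0 : digit (toℕ j) (code hub) ≡ 0ℙ
      digit≡0 = trans (cong (digit (toℕ j)) code-hub≡0) (digit-high (toℕ j) 0 (m^n>0 2 (toℕ j)))

  geodesicH : ∀ x y → Σ (Walk H x y) (IsShortest H)
  geodesicH = geodesic H HAdj? hub hub-adjacent

  separating-walk : ∀ {u v} j → IsCore u → IsCore v → u ≢ v →
    digit (toℕ j) (code u) ≡ 1ℙ → digit (toℕ j) (code v) ≡ 0ℙ →
    Σ (Walk H u (landmark j)) λ p → IsShortest H p × v ∈ verts H p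
  separating-walk {u} {v} j u-core v-core u≢v du dv =
    step uv (step vw here) , shortest-path2 H uv vw u≢w u≁w , there (here refl)
    where
    uv : HAdj u v
    uv = core-adjacent u-core v-core u≢v
    vw : HAdj v (landmark j)
    vw = (λ { refl → landmark-not-core j v-core }) , (λ c → cut-not-core c v-core) ,
         λ { (j′ , e , _ , dv′) →
               0ℙ≢1ℙ (trans (sym dv) (subst (λ i → digit (toℕ i) (code v) ≡ 1ℙ) (sym (landmark-injective e)) dv′)) }
    u≢w : u ≢ landmark j
    u≢w refl = landmark-not-core j u-core
    u≁w : ¬ HAdj u (landmark j)
    u≁w (_ , _ , uncut) = uncut (j , refl , u-core , du)

  core-resolved : ∀ {u v} j → IsCore u → IsCore v → u ≢ v →
    digit (toℕ j) (code u) ≢ digit (toℕ j) (code v) → StronglyResolves H (landmark j) u v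
  core-resolved {u} {v} j u-core v-core u≢v differ
    with digit (toℕ j) (code u) in du | digit (toℕ j) (code v) in dv
  ... | 1ℙ | 0ℙ = inj₁ (separating-walk j u-core v-core u≢v du dv)
  ... | 0ℙ | 1ℙ = inj₂ (separating-walk j v-core u-core (u≢v ∘ sym) dv du)
  ... | 0ℙ | 0ℙ = ⊥-elim (differ refl)
  ... | 1ℙ | 1ℙ = ⊥-elim (differ refl)

  landmarks : Subset n
  landmarks = listSubset (List.tabulate landmark)

  landmark∈ : ∀ j → landmark j ∈ₛ landmarks
  landmark∈ j = ∈-listSubset (∈-tabulate⁺ j)

  non-core∈ : ∀ v → ¬ IsCore v → v ∈ₛ landmarks
  non-core∈ v not-core = let j , e = landmark-cover v not-core in subst (_∈ₛ landmarks) e (landmark∈ j)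

  ∣landmarks∣≤k : ∣ landmarks ∣ ≤ k
  ∣landmarks∣≤k = ≤-trans (∣listSubset∣≤length (List.tabulate landmark)) (≤-reflexive (length-tabulate landmark))

  landmarks-resolve : IsStrongResolvingSet H landmarks
  landmarks-resolve u v u≢v with pos u <? m | pos v <? m
  ... | _             | no v-landmark = v , non-core∈ v v-landmark , endpoint-resolves H (geodesicH u v)
  ... | no u-landmark | yes _         = u , non-core∈ u u-landmark , Sum.swap (endpoint-resolves H (geodesicH v u))
  ... | yes u-core    | yes v-core    =
    let j , differ = distinguishing-digit k (code<2^k u-core) (code<2^k v-core) (u≢v ∘ code-injective) in
    landmark j , landmark∈ j , core-resolved j u-core v-core u≢v differ

  extension : ThresholdStrongDimAtMost T k
  extension = H , T⊆H , (λ x y → proj₁ (geodesicH x y)) , landmarks , landmarks-resolve , ∣landmarks∣≤k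

theorem5p2 : (n : ℕ) → n ≥ 2 → (T : Graph n) → IsTree T → ThresholdStrongDimAtMost T ⌈log₂ n ⌉
theorem5p2 (suc n) n≥2 T tree =
  Extension.extension T (treeOrdering T tree F.zero) ⌈log₂ suc n ⌉
    (0<⌈log₂n⌉ n≥2) (⌈log₂n⌉<n n) (n≤2^⌈log₂n⌉ (suc n))
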